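{- Let $q\ge 3$ be a prime and let $\alpha,\beta\ge 1$ be integers. Then the oriented diameter of $Pow(\mathbb{Z}_{2^{\alpha}q^{\beta}})$ is $2$, except when $(\alpha,\beta,q)=(1,1,3)$.
   Context: $\mathbb{Z}_m$ denotes the cyclic group of order $m$. For a finite group $G$, the power graph $Pow(G)$ is the simple undirected graph with vertex set $G$ in which two distinct elements $x,y$ are adjacent if and only if one of them is an integer power of the other. An orientation of an undirected graph $X$ assigns exactly one direction to each edge of $X$. For a directed graph $D$, $d_D(u,v)$ is the length of a shortest directed path from $u$ to $v$ ($\infty$ if none exists), and $diam(D)=\max_{u,v} d_D(u,v)$. The oriented diameter $OD(X)$ of $X$ is the minimum of $diam(D)$ over all directed graphs $D$ obtained from $X$ by an orientation. -}

module Defs where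

open import Data.Nat using (ℕ; zero; suc; _+_; _*_; _^_; _≤_; _%_; NonZero)
open import Data.Fin using (Fin; toℕ)
open import Data.Product using (Σ; ∃; _×_; _,_)
open import Data.Sum using (_⊎_)
open import Relation.Nullary using (¬_)
open import Relation.Binary.PropositionalEquality using (_≡_; _≢_)

-- The cyclic group Z_m is modelled as Fin m with addition mod m.
-- In additive notation, "x is an integer power of y" means x = k·y in Z_m
-- for some integer k; since y has finite order, nonnegative k suffice.
IsPowerOf : (m : ℕ) .{{_ : NonZero m}} → Fin m → Fin m → Set
IsPowerOf m x y = ∃ λ (k : ℕ) → (k * toℕ y) % m ≡ toℕ x

PowAdj : (m : ℕ) .{{_ : NonZero m}} → Fin m → Fin m → Set
PowAdj m x y = x ≢ y × (IsPowerOf m x y ⊎ IsPowerOf m y x)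

IsOrientation : {V : Set} → (Adj : V → V → Set) → (Arc : V → V → Set) → Set
IsOrientation {V} Adj Arc =
  ((x y : V) → Arc x y → Adj x y) ×
  ((x y : V) → Adj x y → Arc x y ⊎ Arc y x) ×
  ((x y : V) → Arc x y → ¬ Arc y x)

data Walk {V : Set} (Arc : V → V → Set) : ℕ → V → V → Set where
  here  : ∀ {x} → Walk Arc zero x x
  step  : ∀ {n x y z} → Arc x y → Walk Arc n y z → Walk Arc (suc n) x z

DistLe : {V : Set} → (V → V → Set) → V → V → ℕ → Set
DistLe Arc u v d = ∃ λ n → n ≤ d × Walk Arc n u v

DiamLe : {V : Set} → (V → V → Set) → ℕ → Set
DiamLe {V} Arc d = (u v : V) → DistLe Arc u v d

-- OD(X) = suc d : some orientation has diameter ≤ suc d, and no orientation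
-- has diameter ≤ d.  (Since diam takes values in ℕ ∪ {∞}, this is exactly
-- "the minimum of diam over orientations equals suc d".)
ODIs : {V : Set} → (V → V → Set) → ℕ → Set₁
ODIs {V} Adj zero =
  (Σ (V → V → Set) λ Arc → IsOrientation Adj Arc × DiamLe Arc zero)
ODIs {V} Adj (suc d) =
  (Σ (V → V → Set) λ Arc → IsOrientation Adj Arc × DiamLe Arc (suc d)) ×
  ((Arc : V → V → Set) → IsOrientation Adj Arc → ¬ DiamLe Arc d)

{-# OPTIONS --safe #-}
-- Write n = 2^α Q with Q = q^β. The gcd of an odd residue with n divides Q, so any two odd
-- residues are comparable in Pow(ℤ_n) and those prime to q generate ℤ_n, while h ↦ 2h makes the
-- even residues a copy of Pow(ℤ_{n/2}). On ℕ, let s beat t when t lies an odd distance above s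
-- or a positive even distance below it; this tournament has diameter two on every interval of
-- odd length. An orientation of diameter two of Pow(ℤ_{2m}), m even, is built from one of
-- Pow(ℤ_m): keep it on the even residues, let the odd residues other than 1 beat their even
-- neighbours, the even residues beat 1, and 1 beat the other odd residues, which are ordered by
-- the tournament on their halves. The tower starts at ℤ_{2Q} for Q ≥ 5, where the even residues
-- (a copy of the complete graph Pow(ℤ_Q)) are ordered by the tournament too, and at a checked
-- table for ℤ₁₂ when Q = 3.
--
-- In ℤ₆ the residue 3 has only the neighbours 0, 1 and 5, so in an orientation it has at most
-- one out-neighbour or at most one in-neighbour a, say the former. Diameter two forces a to beat
-- every vertex other than 3, so walks of length two into a pass through 3, and 2, which is not
-- adjacent to 3, cannot reach a. No orientation has diameter one.
module Submission where

open import Defs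
open import Data.Nat using (ℕ; _*_; _^_; _≤_; _≥_; NonZero)
open import Data.Nat.Primality using (Prime)
open import Data.Fin using (Fin)
open import Data.Product using (_×_)
open import Relation.Nullary using (¬_)
open import Relation.Binary.PropositionalEquality using (_≡_)
open import Function.Bundles using (_⇔_)

open import Data.Nat.Base using (zero; suc; _+_; _<_; z≤n; s≤s; >-nonZero; parity; ⌊_/2⌋)
open import Data.Nat.Properties
open import Data.Nat.DivMod
  using (_%_; [m+kn]%n≡m%n; m<n⇒m%n≡m; m%n<n; %-distribˡ-*; m%n%n≡m%n; m%n*o≡m*o%[n*o]; %-congˡ; %-congʳ)
open import Data.Nat.Divisibility
open import Data.Nat.GCD using (gcd; gcd-GCD; gcd[m,n]∣m; gcd[m,n]∣n; module Bézout)
open import Data.Nat.Coprimality using (Coprime; coprime-divisor)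
open import Data.Nat.Primality using (prime⇒irreducible; prime⇒nonZero; prime[2])
open import Data.Nat.Tactic.RingSolver using (solve-∀)
open import Data.Parity.Base using (Parity; 0ℙ; 1ℙ; _⁻¹) renaming (_*_ to _*ℙ_)
import Data.Parity.Properties as ℙ
open import Data.Fin.Base using (toℕ; fromℕ<) renaming (zero to fzero; suc to fsuc)
open import Data.Fin.Properties using (toℕ<n; toℕ-injective; toℕ-fromℕ<) renaming (_≟_ to _≟ᶠ_)
open import Data.List.Base using (List; []; _∷_)
open import Data.List.Membership.Propositional using (_∈_)
open import Data.List.Membership.DecPropositional _≟_ using (_∈?_)
open import Data.Product using (Σ; ∃; _,_; proj₁; proj₂)
open import Data.Sum using (_⊎_; inj₁; inj₂; swap) renaming (map to map-⊎)
open import Data.Empty using (⊥; ⊥-elim)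
open import Data.Unit using (⊤; tt)
open import Function.Base using (flip; _∘_)
open import Function.Bundles using (mk⇔)
open import Relation.Nullary using (Dec; yes; no)
open import Relation.Nullary.Decidable using (map′; ¬?; _×-dec_; _⊎-dec_; _→-dec_; from-yes; from-no)
open import Relation.Binary.Definitions using (DecidableEquality; tri<; tri≈; tri>)
open import Relation.Binary.PropositionalEquality

-- Parity and halving

Even Odd : ℕ → Set
Even n = parity n ≡ 0ℙ
Odd n = parity n ≡ 1ℙ

even-double : ∀ k → Even (k + k)
even-double k = trans (ℙ.+-homo-+ k k) (ℙ.p+p≡0ℙ (parity k))

odd-suc-double : ∀ k → Odd (suc (k + k))
odd-suc-double k = trans (ℙ.+-homo-+ 1 (k + k)) (cong _⁻¹ (even-double k))

even⇒¬odd : ∀ n → Even n → ¬ Odd n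
even⇒¬odd _ e o with () ← trans (sym e) o

odd≢even : ∀ {x y} → Odd x → Even y → x ≢ y
odd≢even {x} ox ey refl = even⇒¬odd x ey ox

odd-+suc : ∀ m → Odd (m + suc m)
odd-+suc m = subst Odd (sym (+-suc m m)) (odd-suc-double m)

even⇒double : ∀ n → Even n → n ≡ ⌊ n /2⌋ + ⌊ n /2⌋
even⇒double zero _ = refl
even⇒double (suc (suc n)) e = cong suc (trans (cong suc (even⇒double n e)) (sym (+-suc _ _)))

odd⇒suc-double : ∀ n → Odd n → n ≡ suc (⌊ n /2⌋ + ⌊ n /2⌋)
odd⇒suc-double (suc zero) _ = refl
odd⇒suc-double (suc (suc n)) o = cong suc (trans (cong suc (odd⇒suc-double n o)) (sym (cong suc (+-suc _ _))))

⌊k+k/2⌋≡k : ∀ k → ⌊ k + k /2⌋ ≡ k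
⌊k+k/2⌋≡k k = sym (n≡⌊n+n/2⌋ k)

⌊1+k+k/2⌋≡k : ∀ k → ⌊ suc (k + k) /2⌋ ≡ k
⌊1+k+k/2⌋≡k zero = refl
⌊1+k+k/2⌋≡k (suc k) rewrite +-suc k k = cong suc (⌊1+k+k/2⌋≡k k)

double-injective : ∀ a b → a + a ≡ b + b → a ≡ b
double-injective a b e = trans (sym (⌊k+k/2⌋≡k a)) (trans (cong ⌊_/2⌋ e) (⌊k+k/2⌋≡k b))

double-<-cancel : ∀ a b → a + a < b + b → a < b
double-<-cancel _ _ lt = ≰⇒> λ b≤a → <⇒≱ lt (+-mono-≤ b≤a b≤a)

parity-split : ∀ o → (∃ λ d → o ≡ d + d) ⊎ (∃ λ d → o ≡ suc (d + d))
parity-split o with parity o in e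
... | 0ℙ = inj₁ (⌊ o /2⌋ , even⇒double o e)
... | 1ℙ = inj₂ (⌊ o /2⌋ , odd⇒suc-double o e)

⌊/2⌋<-cancel : ∀ {x m} → x < m + m → ⌊ x /2⌋ < m
⌊/2⌋<-cancel {x} {m} x< = double-<-cancel ⌊ x /2⌋ m (≤-<-trans h+h≤x x<)
  where
  h+h≤x : ⌊ x /2⌋ + ⌊ x /2⌋ ≤ x
  h+h≤x = subst (⌊ x /2⌋ + ⌊ x /2⌋ ≤_) (⌊n/2⌋+⌈n/2⌉≡n x)
                (+-monoʳ-≤ ⌊ x /2⌋ (⌊n/2⌋≤⌈n/2⌉ x))

suc-double< : ∀ {r m} → r < m → suc (r + r) < m + m
suc-double< {r} r<m = ≤-trans (≤-reflexive (cong suc (sym (+-suc r r)))) (+-mono-≤ r<m r<m)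

odd⇒suc-even : ∀ x → Odd x → Even (suc x)
odd⇒suc-even x o = trans (ℙ.+-homo-+ 1 x) (cong _⁻¹ o)

odd-gap : ∀ {x y} → Odd x → Odd y → x < y → suc (suc x) ≤ y
odd-gap {x} ox oy x<y with m≤n⇒m<n∨m≡n x<y
... | inj₁ x+1<y = x+1<y
... | inj₂ refl = ⊥-elim (even⇒¬odd (suc x) (odd⇒suc-even x ox) oy)

odd≢1⇒1≤⌊/2⌋ : ∀ {x} → Odd x → x ≢ 1 → 1 ≤ ⌊ x /2⌋
odd≢1⇒1≤⌊/2⌋ {x} o x≢1 with ⌊ x /2⌋ in e
... | suc _ = s≤s z≤n
... | zero = ⊥-elim (x≢1 (trans (odd⇒suc-double x o) (cong (λ h → suc (h + h)) e)))

odd-injective : ∀ {x y} → Odd x → Odd y → ⌊ x /2⌋ ≡ ⌊ y /2⌋ → x ≡ y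
odd-injective {x} {y} ox oy e =
  trans (odd⇒suc-double x ox) (trans (cong (λ h → suc (h + h)) e) (sym (odd⇒suc-double y oy)))

even-injective : ∀ {x y} → Even x → Even y → ⌊ x /2⌋ ≡ ⌊ y /2⌋ → x ≡ y
even-injective {x} {y} ex ey e =
  trans (even⇒double x ex) (trans (cong (λ h → h + h) e) (sym (even⇒double y ey)))

even-2* : ∀ m → Even (2 * m)
even-2* m = ℙ.*-homo-* 2 m

suc-even⇒odd : ∀ n → Even (suc n) → Odd n
suc-even⇒odd n e = trans (sym (ℙ.suc-homo-⁻¹ n)) (cong _⁻¹ e)

odd-^ : ∀ {q} → Odd q → ∀ b → Odd (q ^ b)
odd-^ oq zero = refl
odd-^ {q} oq (suc b) = trans (ℙ.*-homo-* q (q ^ b)) (cong₂ _*ℙ_ oq (odd-^ oq b))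

-- The parity tournament

_⇝_ : ℕ → ℕ → Set
s ⇝ t = (∃ λ d → t ≡ s + suc (d + d)) ⊎ (∃ λ d → s ≡ t + suc (suc (d + d)))

private
  gap : ∀ {s t} → s < t → ∃ λ o → t ≡ s + suc o
  gap {s} lt with m≤n⇒∃[o]m+o≡n lt
  ... | o , e = o , trans (sym e) (sym (+-suc s o))

  no-cycle : ∀ s t a b → s ≡ t + suc a → t ≡ s + b → ⊥
  no-cycle s t a b e₁ e₂ = m+1+n≢m s (sym (trans e₁ (trans (cong (_+ suc a) e₂) (rearrange s b a))))
    where
    rearrange : ∀ s b a → s + b + suc a ≡ s + suc (b + a)
    rearrange = solve-∀

⇝-asym : ∀ {s t} → s ⇝ t → ¬ t ⇝ s
⇝-asym {s} {t} (inj₁ (d , e₁)) (inj₁ (d′ , e₂)) = no-cycle s t (d′ + d′) (suc (d + d)) e₂ e₁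
⇝-asym {s} {t} (inj₁ (d , e₁)) (inj₂ (d′ , e₂)) =
  odd≢even (odd-suc-double d′) (even-double d) (sym (suc-injective (+-cancelˡ-≡ s _ _ (trans (sym e₁) e₂))))
⇝-asym {s} {t} (inj₂ (d , e₁)) (inj₁ (d′ , e₂)) = ⇝-asym (inj₁ (d′ , e₂)) (inj₂ (d , e₁))
⇝-asym {s} {t} (inj₂ (d , e₁)) (inj₂ (d′ , e₂)) =
  no-cycle s t (suc (d + d)) (suc (suc (d′ + d′))) e₁ e₂

⇝-irrefl : ∀ {s} → ¬ s ⇝ s
⇝-irrefl p = ⇝-asym p p

private
  ⇝-above : ∀ {s t} → s < t → s ⇝ t ⊎ t ⇝ s
  ⇝-above lt with gap lt
  ... | o , e with parity-split o
  ...   | inj₁ (d , refl) = inj₁ (inj₁ (d , e))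
  ...   | inj₂ (d , refl) = inj₂ (inj₂ (d , e))

⇝-total : ∀ {s t} → s ≢ t → s ⇝ t ⊎ t ⇝ s
⇝-total {s} {t} s≢t with <-cmp s t
... | tri< lt _ _ = ⇝-above lt
... | tri≈ _ e _ = ⊥-elim (s≢t e)
... | tri> _ _ gt = swap (⇝-above gt)

⇝-suc : ∀ s → s ⇝ suc s
⇝-suc s = inj₁ (0 , +-comm 1 s)

private
  odd<even⇒suc≤ : ∀ d K → suc (d + d) ≤ K + K → suc (suc (d + d)) ≤ K + K
  odd<even⇒suc≤ d K le = subst (_≤ K + K) (cong suc (+-suc d d)) (+-mono-≤ d<K d<K)
    where d<K = double-<-cancel d K le

  descend : ∀ {b u s} d t → b < t → t ≤ u → s ≡ t + suc (d + d) →
    ∃ λ r → (b ≤ r × r ≤ u) × s ⇝ r × r ⇝ t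
  descend d (suc t′) b<t t≤u e =
    t′ , (≤-pred b<t , ≤-trans (n≤1+n t′) t≤u) , inj₂ (d , trans e (sym (+-suc t′ _))) , ⇝-suc t′

⇝-reach₂ : ∀ b K {s t} → b ≤ s → s ≤ b + (K + K) → b ≤ t → t ≤ b + (K + K) → s ≢ t →
  s ⇝ t ⊎ ∃ λ r → (b ≤ r × r ≤ b + (K + K)) × s ⇝ r × r ⇝ t
⇝-reach₂ b K {s} {t} b≤s s≤u b≤t t≤u s≢t with <-cmp s t
... | tri≈ _ e _ = ⊥-elim (s≢t e)
... | tri< lt _ _ with gap lt
...   | o , e with parity-split o
...     | inj₁ (d , refl) = inj₁ (inj₁ (d , e))
...     | inj₂ (d , refl) =
          inj₂ (suc s , (m≤n⇒m≤1+n b≤s , ≤-trans lt t≤u) , ⇝-suc s ,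
                inj₁ (d , trans e (+-suc s (suc (d + d)))))
⇝-reach₂ b K {s} {t} b≤s s≤u b≤t t≤u s≢t | tri> _ _ gt with gap gt
...   | o , e with parity-split o
...     | inj₂ (d , refl) = inj₁ (inj₂ (d , e))
...     | inj₁ (d , refl) with m≤n⇒m<n∨m≡n b≤t
...       | inj₁ b<t = inj₂ (descend d t b<t t≤u e)
...       | inj₂ refl = inj₂ (suc s , (m≤n⇒m≤1+n b≤s , s+1≤u) , ⇝-suc s , inj₂ (d , s+1≡))
  where
  s+1≡ : suc s ≡ b + suc (suc (d + d))
  s+1≡ = trans (cong suc e) (sym (+-suc b (suc (d + d))))
  s+1≤u : suc s ≤ b + (K + K)
  s+1≤u = subst (_≤ b + (K + K)) (sym s+1≡)
            (+-monoʳ-≤ b (odd<even⇒suc≤ d K (+-cancelˡ-≤ b _ _ (subst (_≤ b + (K + K)) e s≤u))))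

-- Orientations of diameter two

data Reach₂ {V : Set} (Arc : V → V → Set) : V → V → Set where
  stay : ∀ {x} → Reach₂ Arc x x
  arc  : ∀ {x y} → Arc x y → Reach₂ Arc x y
  via  : ∀ {x y} z → Arc x z → Arc z y → Reach₂ Arc x y

module _ {V : Set} {Arc : V → V → Set} where

  Reach₂⇒DistLe : ∀ {x y} → Reach₂ Arc x y → DistLe Arc x y 2
  Reach₂⇒DistLe stay = 0 , z≤n , here
  Reach₂⇒DistLe (arc a) = 1 , s≤s z≤n , step a here
  Reach₂⇒DistLe (via z a b) = 2 , ≤-refl , step a (step b here)

  DistLe⇒Reach₂ : ∀ {x y} → DistLe Arc x y 2 → Reach₂ Arc x y
  DistLe⇒Reach₂ (0 , _ , here) = stay
  DistLe⇒Reach₂ (1 , _ , step a here) = arc a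
  DistLe⇒Reach₂ (2 , _ , step {y = z} a (step b here)) = via z a b
  DistLe⇒Reach₂ (suc (suc (suc _)) , s≤s (s≤s ()) , _)

  Reach₂-flip : ∀ {x y} → Reach₂ Arc x y → Reach₂ (flip Arc) y x
  Reach₂-flip stay = stay
  Reach₂-flip (arc a) = arc a
  Reach₂-flip (via z a b) = via z b a

  orientation⇒¬DiamLe1 : ∀ {Adj x y} → IsOrientation Adj Arc → x ≢ y → ¬ DiamLe Arc 1
  orientation⇒¬DiamLe1 {x = x} {y} (_ , _ , asym) x≢y diam =
    asym x y (direct x≢y (diam x y)) (direct (x≢y ∘ sym) (diam y x))
    where
    direct : ∀ {u v} → u ≢ v → DistLe Arc u v 1 → Arc u v
    direct u≢v (0 , _ , here) = ⊥-elim (u≢v refl)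
    direct _ (1 , _ , step a here) = a
    direct _ (suc (suc _) , s≤s () , _)

module SoleNeighbour {V : Set} (_≟_ : DecidableEquality V) {Arc : V → V → Set}
         (asym : ∀ {x y} → Arc x y → ¬ Arc y x) (reach : ∀ x y → Reach₂ Arc x y) where

  sole-out-neighbour⇒arc-from : ∀ {v a} → (∀ w → Arc v w → w ≡ a) →
                                ∀ {t} → t ≢ v → t ≢ a → Arc a t
  sole-out-neighbour⇒arc-from {v} sole {t} t≢v t≢a with reach v t
  ... | stay = ⊥-elim (t≢v refl)
  ... | arc v→t = ⊥-elim (t≢a (sole t v→t))
  ... | via z v→z z→t = subst (λ z → Arc z t) (sole z v→z) z→t

  -- a beats every vertex except v, so a walk of length two into a can only pass through v.
  sole-out-neighbour⇒arc-to : ∀ {v a} → (∀ w → Arc v w → w ≡ a) →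
                              ∀ {u} → u ≢ v → u ≢ a → Arc u v
  sole-out-neighbour⇒arc-to {v} {a} sole {u} u≢v u≢a with reach u a
  ... | stay = ⊥-elim (u≢a refl)
  ... | arc u→a = ⊥-elim (asym u→a (sole-out-neighbour⇒arc-from sole u≢v u≢a))
  ... | via w u→w w→a with w ≟ v | w ≟ a
  ...   | yes refl | _ = u→w
  ...   | no _ | yes refl = ⊥-elim (asym u→w (sole-out-neighbour⇒arc-from sole u≢v u≢a))
  ...   | no w≢v | no w≢a = ⊥-elim (asym w→a (sole-out-neighbour⇒arc-from sole w≢v w≢a))

Reach₂-map : ∀ {V W : Set} {A : V → V → Set} {B : W → W → Set} (f : V → W) →
  (∀ {x y} → A x y → B (f x) (f y)) → ∀ {x y} → Reach₂ A x y → Reach₂ B (f x) (f y)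
Reach₂-map f g stay = stay
Reach₂-map f g (arc a) = arc (g a)
Reach₂-map f g (via z a b) = via (f z) (g a) (g b)

-- Power graphs of cyclic groups

PowerOf : (n : ℕ) .{{_ : NonZero n}} → ℕ → ℕ → Set
PowerOf n x y = ∃ λ k → (k * y) % n ≡ x

-- Pow(ℤ_{1+M}) on the representatives 0, …, M.
Adj : ℕ → ℕ → ℕ → Set
Adj M x y = x < suc M × y < suc M × x ≢ y × (PowerOf (suc M) x y ⊎ PowerOf (suc M) y x)

Adj-sym : ∀ {M x y} → Adj M x y → Adj M y x
Adj-sym (x< , y< , x≢y , inj₁ p) = y< , x< , x≢y ∘ sym , inj₂ p
Adj-sym (x< , y< , x≢y , inj₂ p) = y< , x< , x≢y ∘ sym , inj₁ p

PowerOf-0 : ∀ M x → PowerOf (suc M) 0 x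
PowerOf-0 M x = 0 , refl

PowerOf-1 : ∀ {M y} → y < suc M → PowerOf (suc M) y 1
PowerOf-1 {M} {y} y< = y , trans (%-congˡ (*-identityʳ y)) (m<n⇒m%n≡m y<)

private
  [c*m]%n≡[c*[m%n]]%n : ∀ c m n .{{_ : NonZero n}} → (c * m) % n ≡ (c * (m % n)) % n
  [c*m]%n≡[c*[m%n]]%n c m n = begin
    (c * m) % n                   ≡⟨ %-distribˡ-* c m n ⟩
    ((c % n) * (m % n)) % n       ≡⟨ cong (λ r → ((c % n) * r) % n) (sym (m%n%n≡m%n m n)) ⟩
    ((c % n) * (m % n % n)) % n   ≡⟨ sym (%-distribˡ-* c (m % n) n) ⟩
    (c * (m % n)) % n             ∎
    where open ≡-Reasoning

gcd%n-PowerOf : ∀ M x → PowerOf (suc M) (gcd x (suc M) % suc M) x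
gcd%n-PowerOf M x with Bézout.identity (gcd-GCD x (suc M))
... | Bézout.+- a b eq = a , (begin
      (a * x) % N           ≡⟨ %-congˡ (sym eq) ⟩
      (g + b * N) % N       ≡⟨ [m+kn]%n≡m%n g b N ⟩
      g % N                 ∎)
  where
  open ≡-Reasoning
  N g : ℕ
  N = suc M
  g = gcd x N
... | Bézout.-+ a b eq = M * a , (begin
      (M * a * x) % N             ≡⟨ sym ([m+kn]%n≡m%n (M * a * x) g N) ⟩
      (M * a * x + g * N) % N     ≡⟨ %-congˡ (regroup M a x g) ⟩
      (M * (g + a * x) + g) % N   ≡⟨ %-congˡ (cong (λ r → M * r + g) eq) ⟩
      (M * (b * N) + g) % N       ≡⟨ %-congˡ (+-comm (M * (b * N)) g) ⟩
      (g + M * (b * N)) % N       ≡⟨ %-congˡ (cong (g +_) (sym (*-assoc M b N))) ⟩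
      (g + M * b * N) % N         ≡⟨ [m+kn]%n≡m%n g (M * b) N ⟩
      g % N                       ∎)
  where
  open ≡-Reasoning
  N g : ℕ
  N = suc M
  g = gcd x N
  -- −a·x ≡ g (mod N), and M = N − 1 plays the role of −1.
  regroup : ∀ M a x g → M * a * x + g * suc M ≡ M * (g + a * x) + g
  regroup = solve-∀

gcd∣⇒PowerOf : ∀ {M x y} → y < suc M → gcd x (suc M) ∣ y → PowerOf (suc M) y x
gcd∣⇒PowerOf {M} {x} {y} y< (divides c y≡c*g) with gcd%n-PowerOf M x
... | k , kx≡g = c * k , (begin
      (c * k * x) % N         ≡⟨ %-congˡ (*-assoc c k x) ⟩
      (c * (k * x)) % N       ≡⟨ [c*m]%n≡[c*[m%n]]%n c (k * x) N ⟩
      (c * ((k * x) % N)) % N ≡⟨ cong (λ r → (c * r) % N) kx≡g ⟩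
      (c * (g % N)) % N       ≡⟨ sym ([c*m]%n≡[c*[m%n]]%n c g N) ⟩
      (c * g) % N             ≡⟨ %-congˡ (sym y≡c*g) ⟩
      y % N                   ≡⟨ m<n⇒m%n≡m y< ⟩
      y                       ∎)
  where
  open ≡-Reasoning
  N g : ℕ
  N = suc M
  g = gcd x N

∣p^β⇒≡p^j : ∀ {p} → Prime p → ∀ β {d} → d ∣ p ^ β → ∃ λ j → d ≡ p ^ j
∣p^β⇒≡p^j pp zero d∣1 = 0 , ∣1⇒≡1 d∣1
∣p^β⇒≡p^j {p} pp (suc β) {d} d∣ with p ∣? d
... | yes (divides e d≡e*p) with ∣p^β⇒≡p^j pp β e∣p^β
  where
  instance _ = prime⇒nonZero pp
  e∣p^β : e ∣ p ^ β
  e∣p^β = *-cancelʳ-∣ p (subst₂ _∣_ d≡e*p (*-comm p (p ^ β)) d∣)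
...   | j , e≡p^j = suc j , trans d≡e*p (trans (cong (_* p) e≡p^j) (*-comm (p ^ j) p))
∣p^β⇒≡p^j {p} pp (suc β) {d} d∣ | no p∤d = ∣p^β⇒≡p^j pp β (coprime-divisor d⊥p d∣)
  where
  d⊥p : Coprime d p
  d⊥p (c∣d , c∣p) with prime⇒irreducible pp c∣p
  ... | inj₁ c≡1 = c≡1
  ... | inj₂ refl = ⊥-elim (p∤d c∣d)

p^∣p^ : ∀ p {i j} → i ≤ j → p ^ i ∣ p ^ j
p^∣p^ p {i} i≤j with m≤n⇒∃[o]m+o≡n i≤j
... | o , refl = divides (p ^ o) (trans (^-distribˡ-+-* p i o) (*-comm (p ^ i) (p ^ o)))

∣p^β-total : ∀ {p} → Prime p → ∀ β {d e} → d ∣ p ^ β → e ∣ p ^ β → d ∣ e ⊎ e ∣ d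
∣p^β-total {p} pp β d∣ e∣ with ∣p^β⇒≡p^j pp β d∣ | ∣p^β⇒≡p^j pp β e∣
... | i , refl | j , refl with ≤-total i j
...   | inj₁ i≤j = inj₁ (p^∣p^ p i≤j)
...   | inj₂ j≤i = inj₂ (p^∣p^ p j≤i)

odd⇒2∤ : ∀ {x} → Odd x → ¬ 2 ∣ x
odd⇒2∤ {x} o (divides c refl) = even⇒¬odd (c * 2) (trans (ℙ.*-homo-* c 2) (ℙ.*-zeroʳ (parity c))) o

2∤⇒odd : ∀ {x} → ¬ 2 ∣ x → Odd x
2∤⇒odd {x} 2∤x with parity x in e
... | 1ℙ = refl
... | 0ℙ = ⊥-elim (2∤x (divides ⌊ x /2⌋ (trans (even⇒double x e) (+-*2 ⌊ x /2⌋))))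
  where
  +-*2 : ∀ h → h + h ≡ h * 2
  +-*2 = solve-∀

gcd[odd,2^a*m]∣m : ∀ a m {x} → Odd x → gcd x (2 ^ a * m) ∣ m
gcd[odd,2^a*m]∣m a m {x} o = coprime-divisor g⊥2^a (gcd[m,n]∣n x (2 ^ a * m))
  where
  g⊥2^a : Coprime (gcd x (2 ^ a * m)) (2 ^ a)
  g⊥2^a (c∣g , c∣2^a) with ∣p^β⇒≡p^j prime[2] a c∣2^a
  ... | zero , c≡1 = c≡1
  ... | suc i , refl = ⊥-elim (odd⇒2∤ o (∣-trans (∣-trans (m∣m*n (2 ^ i)) c∣g) (gcd[m,n]∣m x _)))

module _ {p} (pp : Prime p) (β M : ℕ) where

  gcds∣p^β⇒comparable : ∀ {x y} → x < suc M → y < suc M →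
    gcd x (suc M) ∣ p ^ β → gcd y (suc M) ∣ p ^ β → PowerOf (suc M) x y ⊎ PowerOf (suc M) y x
  gcds∣p^β⇒comparable {x} {y} x< y< gx gy with ∣p^β-total pp β gx gy
  ... | inj₁ gx∣gy = inj₂ (gcd∣⇒PowerOf y< (∣-trans gx∣gy (gcd[m,n]∣m y (suc M))))
  ... | inj₂ gy∣gx = inj₁ (gcd∣⇒PowerOf x< (∣-trans gy∣gx (gcd[m,n]∣m x (suc M))))

  gcd∣p^β∧p∤⇒generator : ∀ {u y} → y < suc M → ¬ p ∣ u → gcd u (suc M) ∣ p ^ β →
                          PowerOf (suc M) y u
  gcd∣p^β∧p∤⇒generator {u} {y} y< p∤u gu with ∣p^β⇒≡p^j pp β gu
  ... | zero , g≡1 = gcd∣⇒PowerOf y< (subst (_∣ y) (sym g≡1) (1∣ y))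
  ... | suc j , g≡p^j+1 =
        ⊥-elim (p∤u (∣-trans (∣-trans (m∣m*n (p ^ j)) (∣-reflexive (sym g≡p^j+1))) (gcd[m,n]∣m u (suc M))))

∣⇒∤small+ : ∀ {q a d} → q ∣ a → 0 < d → d < q → ¬ q ∣ d + a
∣⇒∤small+ {q} {a} {suc _} q∣a _ d<q q∣d+a =
  <⇒≱ d<q (∣⇒≤ (∣m+n∣m⇒∣n (subst (q ∣_) (+-comm _ a) q∣d+a) q∣a))

[c+c]%[n+n]≡c%n+c%n : ∀ c M → (c + c) % (suc M + suc M) ≡ c % suc M + c % suc M
[c+c]%[n+n]≡c%n+c%n c M = begin
  (c + c) % (suc M + suc M)     ≡⟨ %-congˡ (+≡*2 c) ⟩
  (c * 2) % (suc M + suc M)     ≡⟨ %-congʳ {o = c * 2} (+≡*2 (suc M)) ⟩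
  (c * 2) % (suc M * 2)         ≡⟨ sym (m%n*o≡m*o%[n*o] c (suc M) 2) ⟩
  c % suc M * 2                 ≡⟨ sym (+≡*2 (c % suc M)) ⟩
  c % suc M + c % suc M         ∎
  where
  open ≡-Reasoning
  +≡*2 : ∀ a → a + a ≡ a * 2
  +≡*2 = solve-∀

module _ (M : ℕ) where

  PowerOf-double : ∀ {a b} → PowerOf (suc M) a b → PowerOf (suc M + suc M) (a + a) (b + b)
  PowerOf-double {b = b} (k , e) =
    k , trans (%-congˡ (*-distribˡ-+ k b b)) (trans ([c+c]%[n+n]≡c%n+c%n (k * b) M) (cong₂ _+_ e e))

  PowerOf-halve : ∀ {a b} → PowerOf (suc M + suc M) (a + a) (b + b) → PowerOf (suc M) a b
  PowerOf-halve {a} {b} (k , e) =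
    k , double-injective _ a
          (trans (sym ([c+c]%[n+n]≡c%n+c%n (k * b) M)) (trans (%-congˡ (sym (*-distribˡ-+ k b b))) e))

  Adj-double : ∀ {a b} → Adj M a b → Adj (M + suc M) (a + a) (b + b)
  Adj-double {a} {b} (a< , b< , a≢b , p) =
    +-mono-< a< a< , +-mono-< b< b< , a≢b ∘ double-injective a b , map-⊎ PowerOf-double PowerOf-double p

  Adj-halve : ∀ {a b} → Adj (M + suc M) (a + a) (b + b) → Adj M a b
  Adj-halve {a} {b} (a< , b< , a≢b , p) =
    double-<-cancel a (suc M) a< , double-<-cancel b (suc M) b< , (λ a≡b → a≢b (cong₂ _+_ a≡b a≡b)) ,
    map-⊎ PowerOf-halve PowerOf-halve p

PowerOf-reduce : ∀ {M x y} → PowerOf (suc M) x y → ∃ λ k → k < suc M × (k * y) % suc M ≡ x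
PowerOf-reduce {M} {x} {y} (k , e) = k % suc M , m%n<n k (suc M) , (begin
  (k % n * y) % n            ≡⟨ %-distribˡ-* (k % n) y n ⟩
  (k % n % n * (y % n)) % n  ≡⟨ cong (λ r → (r * (y % n)) % n) (m%n%n≡m%n k n) ⟩
  (k % n * (y % n)) % n      ≡⟨ sym (%-distribˡ-* k y n) ⟩
  (k * y) % n                ≡⟨ e ⟩
  x                          ∎)
  where
  open ≡-Reasoning
  n : ℕ
  n = suc M

PowerOf? : ∀ M x y → Dec (PowerOf (suc M) x y)
PowerOf? M x y = map′ (λ (k , _ , e) → k , e) PowerOf-reduce (anyUpTo? (λ k → (k * y) % suc M ≟ x) (suc M))

Adj? : ∀ M x y → Dec (Adj M x y)
Adj? M x y = x <? suc M ×-dec y <? suc M ×-dec ¬? (x ≟ y) ×-dec (PowerOf? M x y ⊎-dec PowerOf? M y x)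

record Diam₂Orientation (M : ℕ) : Set₁ where
  field
    Arc   : ℕ → ℕ → Set
    sound : ∀ {x y} → Arc x y → Adj M x y
    total : ∀ {x y} → Adj M x y → Arc x y ⊎ Arc y x
    asym  : ∀ {x y} → Arc x y → ¬ Arc y x
    reach : ∀ {x y} → x < suc M → y < suc M → Reach₂ Arc x y

Diam₂Orientation⇒ODIs : ∀ {M} → Diam₂Orientation (suc M) →
  ∀ n .{{_ : NonZero n}} → n ≡ suc (suc M) → ODIs (PowAdj n) 2
Diam₂Orientation⇒ODIs {M} D n refl = (Arcᶠ , orientation , diam) , λ _ o → orientation⇒¬DiamLe1 o 0≢1
  where
  open Diam₂Orientation D
  Arcᶠ : Fin n → Fin n → Set
  Arcᶠ x y = Arc (toℕ x) (toℕ y)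
  orientation : IsOrientation (PowAdj n) Arcᶠ
  orientation = (λ x y a → let (_ , _ , x≢y , p) = sound a in x≢y ∘ cong toℕ , p)
              , (λ x y (x≢y , p) → total (toℕ<n x , toℕ<n y , x≢y ∘ toℕ-injective , p))
              , (λ x y → asym)
  lift : ∀ {x y} → Reach₂ Arc x y → ∀ u v → x ≡ toℕ u → y ≡ toℕ v → Reach₂ Arcᶠ u v
  lift stay u v refl e = subst (Reach₂ Arcᶠ u) (toℕ-injective e) stay
  lift (arc a) u v refl refl = arc a
  lift (via z a b) u v refl refl = via w (subst (Arc (toℕ u)) z≡w a) (subst (λ t → Arc t (toℕ v)) z≡w b)
    where
    z< : z < n
    z< = proj₁ (proj₂ (sound a))
    w : Fin n
    w = fromℕ< z<
    z≡w : z ≡ toℕ w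
    z≡w = sym (toℕ-fromℕ< z<)
  diam : DiamLe Arcᶠ 2
  diam u v = Reach₂⇒DistLe (lift (reach (toℕ<n u) (toℕ<n v)) u v refl refl)
  0≢1 : fzero {suc M} ≢ fsuc fzero
  0≢1 ()

record OddResidues (M : ℕ) : Set where
  field
    q              : ℕ
    2<q            : 2 < q
    q-odd          : Odd q
    q∣n            : q ∣ suc M
    odd-comparable : ∀ {x y} → x < suc M → y < suc M → Odd x → Odd y →
                     PowerOf (suc M) x y ⊎ PowerOf (suc M) y x
    odd-generator  : ∀ {u y} → u < suc M → y < suc M → Odd u → ¬ q ∣ u → PowerOf (suc M) y u

  q∤M : ¬ q ∣ M
  q∤M q∣M = ∣⇒∤small+ q∣M (s≤s z≤n) (<-trans (s≤s (s≤s z≤n)) 2<q) q∣n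

  generator-Adj : ∀ {u y} → u < suc M → y < suc M → Odd u → ¬ q ∣ u → u ≢ y → Adj M u y
  generator-Adj u< y< ou q∤u u≢y = u< , y< , u≢y , inj₂ (odd-generator u< y< ou q∤u)

-- From ℤ_m to ℤ_{2m}

module Doubling (K : ℕ) (G′ : Diam₂Orientation (suc (K + K)))
                (R : OddResidues (suc (K + K) + suc (suc (K + K)))) where

  open OddResidues R
  private module G′ = Diam₂Orientation G′

  M′ M : ℕ
  M′ = suc (K + K)
  M = M′ + suc M′

  OddArc : ℕ → ℕ → Set
  OddArc x y = (x ≡ 1 × y ≢ 1) ⊎ (x ≢ 1 × y ≢ 1 × ⌊ x /2⌋ ⇝ ⌊ y /2⌋)

  ArcP : Parity → Parity → ℕ → ℕ → Set
  ArcP 0ℙ 0ℙ x y = G′.Arc ⌊ x /2⌋ ⌊ y /2⌋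
  ArcP 1ℙ 0ℙ x y = Adj M x y × x ≢ 1
  ArcP 0ℙ 1ℙ x y = Adj M x y × y ≡ 1
  ArcP 1ℙ 1ℙ x y = Adj M x y × OddArc x y

  Arc : ℕ → ℕ → Set
  Arc x y = ArcP (parity x) (parity y) x y

  by-parity : ∀ x y {p p′} → parity x ≡ p → parity y ≡ p′ → ArcP p p′ x y → Arc x y
  by-parity x y refl refl a = a

  soundP : ∀ p p′ {x y} → parity x ≡ p → parity y ≡ p′ → ArcP p p′ x y → Adj M x y
  soundP 0ℙ 0ℙ {x} {y} ex ey a =
    subst₂ (Adj M) (sym (even⇒double x ex)) (sym (even⇒double y ey)) (Adj-double M′ (G′.sound a))
  soundP 1ℙ 0ℙ _ _ (adj , _) = adj
  soundP 0ℙ 1ℙ _ _ (adj , _) = adj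
  soundP 1ℙ 1ℙ _ _ (adj , _) = adj

  sound : ∀ {x y} → Arc x y → Adj M x y
  sound {x} {y} = soundP (parity x) (parity y) refl refl

  totalP : ∀ p p′ {x y} → parity x ≡ p → parity y ≡ p′ → Adj M x y → Arc x y ⊎ Arc y x
  totalP 0ℙ 0ℙ {x} {y} ex ey adj
    with G′.total (Adj-halve M′ {⌊ x /2⌋} {⌊ y /2⌋}
                     (subst₂ (Adj M) (even⇒double x ex) (even⇒double y ey) adj))
  ... | inj₁ a = inj₁ (by-parity x y ex ey a)
  ... | inj₂ a = inj₂ (by-parity y x ey ex a)
  totalP 1ℙ 0ℙ {x} {y} ex ey adj with x ≟ 1
  ... | yes x≡1 = inj₂ (by-parity y x ey ex (Adj-sym adj , x≡1))
  ... | no x≢1 = inj₁ (by-parity x y ex ey (adj , x≢1))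
  totalP 0ℙ 1ℙ {x} {y} ex ey adj with y ≟ 1
  ... | yes y≡1 = inj₁ (by-parity x y ex ey (adj , y≡1))
  ... | no y≢1 = inj₂ (by-parity y x ey ex (Adj-sym adj , y≢1))
  totalP 1ℙ 1ℙ {x} {y} ex ey adj@(_ , _ , x≢y , _) with x ≟ 1 | y ≟ 1
  ... | yes x≡1 | _ = inj₁ (by-parity x y ex ey (adj , inj₁ (x≡1 , λ y≡1 → x≢y (trans x≡1 (sym y≡1)))))
  ... | no x≢1 | yes y≡1 = inj₂ (by-parity y x ey ex (Adj-sym adj , inj₁ (y≡1 , x≢1)))
  ... | no x≢1 | no y≢1 with ⇝-total (x≢y ∘ odd-injective ex ey)
  ...   | inj₁ p = inj₁ (by-parity x y ex ey (adj , inj₂ (x≢1 , y≢1 , p)))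
  ...   | inj₂ p = inj₂ (by-parity y x ey ex (Adj-sym adj , inj₂ (y≢1 , x≢1 , p)))

  total : ∀ {x y} → Adj M x y → Arc x y ⊎ Arc y x
  total {x} {y} = totalP (parity x) (parity y) refl refl

  OddArc-asym : ∀ {x y} → OddArc x y → ¬ OddArc y x
  OddArc-asym (inj₁ (_ , y≢1)) (inj₁ (y≡1 , _)) = y≢1 y≡1
  OddArc-asym (inj₁ (x≡1 , _)) (inj₂ (_ , x≢1 , _)) = x≢1 x≡1
  OddArc-asym (inj₂ (_ , y≢1 , _)) (inj₁ (y≡1 , _)) = y≢1 y≡1
  OddArc-asym (inj₂ (_ , _ , p)) (inj₂ (_ , _ , p′)) = ⇝-asym p p′

  asymP : ∀ p p′ {x y} → ArcP p p′ x y → ¬ ArcP p′ p y x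
  asymP 0ℙ 0ℙ a b = G′.asym a b
  asymP 1ℙ 0ℙ (_ , x≢1) (_ , x≡1) = x≢1 x≡1
  asymP 0ℙ 1ℙ (_ , y≡1) (_ , y≢1) = y≢1 y≡1
  asymP 1ℙ 1ℙ (_ , a) (_ , b) = OddArc-asym a b

  asym : ∀ {x y} → Arc x y → ¬ Arc y x
  asym {x} {y} = asymP (parity x) (parity y)

  M-odd : Odd M
  M-odd = odd-+suc M′

  M≢1 : M ≢ 1
  M≢1 M≡1 = <-irrefl (sym M≡1) (≤-trans (s≤s (s≤s z≤n)) (m≤n+m (suc M′) M′))

  1<n : 1 < suc M
  1<n = s≤s (≤-trans (s≤s z≤n) (m≤n+m (suc M′) M′))

  even→1 : ∀ {x} → x < suc M → Even x → Arc x 1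
  even→1 {x} x< ex = by-parity x 1 ex refl ((x< , 1<n , odd≢even refl ex ∘ sym , inj₁ (PowerOf-1 x<)) , refl)

  1→odd : ∀ {y} → y < suc M → Odd y → y ≢ 1 → Arc 1 y
  1→odd {y} y< oy y≢1 =
    by-parity 1 y refl oy ((1<n , y< , y≢1 ∘ sym , inj₂ (PowerOf-1 y<)) , inj₁ (refl , y≢1))

  odd-index≤M′ : ∀ {x} → x < suc M → ⌊ x /2⌋ ≤ M′
  odd-index≤M′ x< = ≤-pred (⌊/2⌋<-cancel x<)

  odd⇝odd : ∀ {x y} → x < suc M → y < suc M → Odd x → Odd y → x ≢ 1 → y ≢ 1 →
            ⌊ x /2⌋ ⇝ ⌊ y /2⌋ → Arc x y
  odd⇝odd {x} {y} x< y< ox oy x≢1 y≢1 p = by-parity x y ox oy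
    ((x< , y< , (λ { refl → ⇝-irrefl p }) , odd-comparable x< y< ox oy) , inj₂ (x≢1 , y≢1 , p))

  reach-even-even : ∀ {x y} → x < suc M → y < suc M → Even x → Even y → Reach₂ Arc x y
  reach-even-even {x} {y} x< y< ex ey =
    subst₂ (Reach₂ Arc) (sym (even⇒double x ex)) (sym (even⇒double y ey))
      (Reach₂-map (λ h → h + h) double-arc (G′.reach (⌊/2⌋<-cancel x<) (⌊/2⌋<-cancel y<)))
    where
    double-arc : ∀ {h h′} → G′.Arc h h′ → Arc (h + h) (h′ + h′)
    double-arc {h} {h′} a = by-parity (h + h) (h′ + h′) (even-double h) (even-double h′)
      (subst₂ G′.Arc (sym (⌊k+k/2⌋≡k h)) (sym (⌊k+k/2⌋≡k h′)) a)

  reach-even-odd : ∀ {x y} → x < suc M → y < suc M → Even x → Odd y → Reach₂ Arc x y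
  reach-even-odd {x} {y} x< y< ex oy with y ≟ 1
  ... | yes refl = arc (even→1 x< ex)
  ... | no y≢1 = via 1 (even→1 x< ex) (1→odd y< oy y≢1)

  reach-odd-even : ∀ {x y} → x < suc M → y < suc M → Odd x → Even y → Reach₂ Arc x y
  reach-odd-even {x} {y} x< y< ox ey with x ≟ 1
  ... | yes refl = via M (1→odd ≤-refl M-odd M≢1)
                         (by-parity M y M-odd ey (generator-Adj ≤-refl y< M-odd q∤M (odd≢even M-odd ey) , M≢1))
  ... | no x≢1 with q ∣? x
  ...   | no q∤x = arc (by-parity x y ox ey (generator-Adj x< y< ox q∤x (odd≢even ox ey) , x≢1))
  ...   | yes q∣x = via (suc (suc x)) (odd⇝odd x< z< ox ox x≢1 (λ ()) (⇝-suc ⌊ x /2⌋))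
                      (by-parity (suc (suc x)) y ox ey (generator-Adj z< y< ox q∤z (odd≢even ox ey) , λ ()))
    where
    x<M : x < M
    x<M = ≤∧≢⇒< (≤-pred x<) λ { refl → q∤M q∣x }
    z< : suc (suc x) < suc M
    z< = s≤s (odd-gap ox M-odd x<M)
    q∤z : ¬ q ∣ suc (suc x)
    q∤z = ∣⇒∤small+ q∣x (s≤s z≤n) 2<q

  reach-odd-odd : ∀ {x y} → x < suc M → y < suc M → Odd x → Odd y → Reach₂ Arc x y
  reach-odd-odd {x} {y} x< y< ox oy with x ≟ y | x ≟ 1 | y ≟ 1
  ... | yes refl | _ | _ = stay
  ... | no x≢y | yes refl | _ = arc (1→odd y< oy (x≢y ∘ sym))
  ... | no x≢y | no x≢1 | yes refl =
        via 0 (by-parity x 0 ox refl ((x< , s≤s z≤n , odd≢even ox refl , inj₂ (PowerOf-0 M x)) , x≢1))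
              (even→1 (s≤s z≤n) refl)
  ... | no x≢y | no x≢1 | no y≢1
        with ⇝-reach₂ 1 K (odd≢1⇒1≤⌊/2⌋ ox x≢1) (odd-index≤M′ x<)
                          (odd≢1⇒1≤⌊/2⌋ oy y≢1) (odd-index≤M′ y<)
                      (x≢y ∘ odd-injective ox oy)
  ...   | inj₁ p = arc (odd⇝odd x< y< ox oy x≢1 y≢1 p)
  ...   | inj₂ (r , (1≤r , r≤M′) , p₁ , p₂) =
          via (suc (r + r)) (odd⇝odd x< z< ox oz x≢1 z≢1 (subst (_ ⇝_) (sym ⌊z/2⌋≡r) p₁))
                            (odd⇝odd z< y< oz oy z≢1 y≢1 (subst (_⇝ _) (sym ⌊z/2⌋≡r) p₂))
    where
    oz : Odd (suc (r + r))
    oz = odd-suc-double r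
    ⌊z/2⌋≡r : ⌊ suc (r + r) /2⌋ ≡ r
    ⌊z/2⌋≡r = ⌊1+k+k/2⌋≡k r
    z< : suc (r + r) < suc M
    z< = suc-double< (s≤s r≤M′)
    z≢1 : suc (r + r) ≢ 1
    z≢1 e = <-irrefl (sym (trans (sym ⌊z/2⌋≡r) (cong ⌊_/2⌋ e))) 1≤r

  reachP : ∀ p p′ {x y} → parity x ≡ p → parity y ≡ p′ → x < suc M → y < suc M → Reach₂ Arc x y
  reachP 0ℙ 0ℙ ex ey x< y< = reach-even-even x< y< ex ey
  reachP 0ℙ 1ℙ ex oy x< y< = reach-even-odd x< y< ex oy
  reachP 1ℙ 0ℙ ox ey x< y< = reach-odd-even x< y< ox ey
  reachP 1ℙ 1ℙ ox oy x< y< = reach-odd-odd x< y< ox oy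

  orientation : Diam₂Orientation M
  orientation = record
    { Arc = Arc ; sound = sound ; total = total ; asym = λ {x} {y} → asym {x} {y}
    ; reach = λ {x} {y} → reachP (parity x) (parity y) refl refl }

-- ℤ_{2Q} for Q ≥ 5

data Lab : Set where
  one top : Lab
  om : ℕ → Lab

_▷_ : Lab → Lab → Set
one ▷ top = ⊤
one ▷ om i = i ≢ 1
om i ▷ one = i ≡ 1
top ▷ om _ = ⊤
om i ▷ om j = i ⇝ j
_ ▷ _ = ⊥

▷-asym : ∀ a b → a ▷ b → ¬ b ▷ a
▷-asym one top _ ()
▷-asym one (om i) i≢1 i≡1 = i≢1 i≡1
▷-asym top (om i) _ ()
▷-asym (om i) one i≡1 i≢1 = i≢1 i≡1
▷-asym (om i) (om j) p p′ = ⇝-asym p p′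

▷-total : ∀ a b → a ≢ b → a ▷ b ⊎ b ▷ a
▷-total one one a≢b = ⊥-elim (a≢b refl)
▷-total one top _ = inj₁ tt
▷-total one (om i) _ with i ≟ 1
... | yes i≡1 = inj₂ i≡1
... | no i≢1 = inj₁ i≢1
▷-total top one _ = inj₂ tt
▷-total top top a≢b = ⊥-elim (a≢b refl)
▷-total top (om i) _ = inj₁ tt
▷-total (om i) one a≢b = swap (▷-total one (om i) (a≢b ∘ sym))
▷-total (om i) top _ = inj₂ tt
▷-total (om i) (om j) a≢b = ⇝-total (a≢b ∘ cong om)

module Base (K₀ : ℕ) where

  K′ K L N Q M : ℕ
  K′ = suc K₀
  K = suc K′
  L = suc (K′ + K′)
  N = K + K
  Q = suc N
  M = N + Q

  N≡1+L : N ≡ suc L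
  N≡1+L = cong suc (+-suc K′ K′)

  -- The odd residue 2i + 1 is labelled by i: 1 is one, M = 2N + 1 is top, the rest are om i with 1 ≤ i ≤ L.
  label : ℕ → Lab
  label zero = one
  label (suc i) with suc i ≟ N
  ... | yes _ = top
  ... | no _ = om (suc i)

  label-N : label N ≡ top
  label-N with N ≟ N
  ... | yes _ = refl
  ... | no N≢N = ⊥-elim (N≢N refl)

  label-om : ∀ {i} → i ≢ 0 → i ≢ N → label i ≡ om i
  label-om {zero} i≢0 _ = ⊥-elim (i≢0 refl)
  label-om {suc i} _ i≢N with suc i ≟ N
  ... | yes i≡N = ⊥-elim (i≢N i≡N)
  ... | no _ = refl

  label-view : ∀ i → (i ≡ 0 × label i ≡ one) ⊎ (i ≡ N × label i ≡ top) ⊎ label i ≡ om i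
  label-view zero = inj₁ (refl , refl)
  label-view (suc i) with suc i ≟ N
  ... | yes i≡N = inj₂ (inj₁ (i≡N , refl))
  ... | no _ = inj₂ (inj₂ refl)

  label-injective : ∀ {i j} → label i ≡ label j → i ≡ j
  label-injective {i} {j} e with label-view i | label-view j
  ... | inj₁ (i≡0 , _) | inj₁ (j≡0 , _) = trans i≡0 (sym j≡0)
  ... | inj₂ (inj₁ (i≡N , _)) | inj₂ (inj₁ (j≡N , _)) = trans i≡N (sym j≡N)
  ... | inj₂ (inj₂ li) | inj₂ (inj₂ lj) with refl ← trans (sym li) (trans e lj) = refl
  ... | inj₁ (_ , li) | inj₂ (inj₁ (_ , lj)) with () ← trans (sym li) (trans e lj)
  ... | inj₁ (_ , li) | inj₂ (inj₂ lj) with () ← trans (sym li) (trans e lj)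
  ... | inj₂ (inj₁ (_ , li)) | inj₁ (_ , lj) with () ← trans (sym li) (trans e lj)
  ... | inj₂ (inj₁ (_ , li)) | inj₂ (inj₂ lj) with () ← trans (sym li) (trans e lj)
  ... | inj₂ (inj₂ li) | inj₁ (_ , lj) with () ← trans (sym li) (trans e lj)
  ... | inj₂ (inj₂ li) | inj₂ (inj₁ (_ , lj)) with () ← trans (sym li) (trans e lj)

  module Construction (R : OddResidues M)
                      (Q-complete : ∀ {a b} → a < Q → b < Q → PowerOf Q a b ⊎ PowerOf Q b a)
                      (q+4≤M : 4 + OddResidues.q R ≤ M) where

    open OddResidues R

    Mid : ℕ → Set
    Mid x = x ≢ 1 × x ≢ M

    ArcP : Parity → Parity → ℕ → ℕ → Set
    ArcP 0ℙ 0ℙ x y = Adj M x y × ⌊ x /2⌋ ⇝ ⌊ y /2⌋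
    ArcP 1ℙ 0ℙ x y = Adj M x y × Mid x
    ArcP 0ℙ 1ℙ x y = Adj M x y × (y ≡ 1 ⊎ y ≡ M)
    ArcP 1ℙ 1ℙ x y = Adj M x y × label ⌊ x /2⌋ ▷ label ⌊ y /2⌋

    Arc : ℕ → ℕ → Set
    Arc x y = ArcP (parity x) (parity y) x y

    by-parity : ∀ x y {p p′} → parity x ≡ p → parity y ≡ p′ → ArcP p p′ x y → Arc x y
    by-parity x y refl refl a = a

    soundP : ∀ p p′ {x y} → ArcP p p′ x y → Adj M x y
    soundP 0ℙ 0ℙ = proj₁
    soundP 1ℙ 0ℙ = proj₁
    soundP 0ℙ 1ℙ = proj₁
    soundP 1ℙ 1ℙ = proj₁

    totalP : ∀ p p′ {x y} → parity x ≡ p → parity y ≡ p′ → Adj M x y → Arc x y ⊎ Arc y x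
    totalP 0ℙ 0ℙ {x} {y} ex ey adj@(_ , _ , x≢y , _) with ⇝-total (x≢y ∘ even-injective ex ey)
    ... | inj₁ p = inj₁ (by-parity x y ex ey (adj , p))
    ... | inj₂ p = inj₂ (by-parity y x ey ex (Adj-sym adj , p))
    totalP 1ℙ 0ℙ {x} {y} ex ey adj with x ≟ 1 | x ≟ M
    ... | yes x≡1 | _ = inj₂ (by-parity y x ey ex (Adj-sym adj , inj₁ x≡1))
    ... | no _ | yes x≡M = inj₂ (by-parity y x ey ex (Adj-sym adj , inj₂ x≡M))
    ... | no x≢1 | no x≢M = inj₁ (by-parity x y ex ey (adj , x≢1 , x≢M))
    totalP 0ℙ 1ℙ {x} {y} ex ey adj = swap (totalP 1ℙ 0ℙ ey ex (Adj-sym adj))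
    totalP 1ℙ 1ℙ {x} {y} ex ey adj@(_ , _ , x≢y , _)
      with ▷-total (label ⌊ x /2⌋) (label ⌊ y /2⌋) (x≢y ∘ odd-injective ex ey ∘ label-injective)
    ... | inj₁ d = inj₁ (by-parity x y ex ey (adj , d))
    ... | inj₂ d = inj₂ (by-parity y x ey ex (Adj-sym adj , d))

    asymP : ∀ p p′ {x y} → ArcP p p′ x y → ¬ ArcP p′ p y x
    asymP 0ℙ 0ℙ (_ , p) (_ , p′) = ⇝-asym p p′
    asymP 1ℙ 0ℙ (_ , x≢1 , _) (_ , inj₁ x≡1) = x≢1 x≡1
    asymP 1ℙ 0ℙ (_ , _ , x≢M) (_ , inj₂ x≡M) = x≢M x≡M
    asymP 0ℙ 1ℙ (_ , inj₁ y≡1) (_ , y≢1 , _) = y≢1 y≡1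
    asymP 0ℙ 1ℙ (_ , inj₂ y≡M) (_ , _ , y≢M) = y≢M y≡M
    asymP 1ℙ 1ℙ {x} {y} (_ , d) (_ , d′) = ▷-asym (label ⌊ x /2⌋) (label ⌊ y /2⌋) d d′

    ⌊M/2⌋≡N : ⌊ M /2⌋ ≡ N
    ⌊M/2⌋≡N = trans (cong ⌊_/2⌋ (+-suc N N)) (⌊1+k+k/2⌋≡k N)

    M-odd : Odd M
    M-odd = odd-+suc N

    M≢1 : M ≢ 1
    M≢1 M≡1 with () ← trans (sym ⌊M/2⌋≡N) (cong ⌊_/2⌋ M≡1)

    3≤M : 3 ≤ M
    3≤M = ≤-trans (s≤s (s≤s (s≤s z≤n))) (m≤n+m Q N)

    M< : M < suc M
    M< = ≤-refl

    1< : 1 < suc M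
    1< = s≤s (≤-trans (s≤s z≤n) 3≤M)

    mid-index : ∀ {x} → Odd x → x < suc M → Mid x → 1 ≤ ⌊ x /2⌋ × ⌊ x /2⌋ ≤ L
    mid-index {x} ox x< (x≢1 , x≢M) = odd≢1⇒1≤⌊/2⌋ ox x≢1 , ≤-pred (subst (⌊ x /2⌋ <_) N≡1+L i<N)
      where
      i<N : ⌊ x /2⌋ < N
      i<N = ≤∧≢⇒< (≤-pred (⌊/2⌋<-cancel x<))
                  (λ i≡N → x≢M (odd-injective ox M-odd (trans i≡N (sym ⌊M/2⌋≡N))))

    index≤L⇒< : ∀ {z} → Odd z → ⌊ z /2⌋ ≤ L → z < suc M
    index≤L⇒< {z} oz i≤L = subst (_< suc M) (sym (odd⇒suc-double z oz))
      (suc-double< (m≤n⇒m≤1+n (subst (suc ⌊ z /2⌋ ≤_) (sym N≡1+L) (s≤s i≤L))))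

    index⇒mid : ∀ {z} → 1 ≤ ⌊ z /2⌋ → ⌊ z /2⌋ ≤ L → Mid z
    index⇒mid {z} 1≤i i≤L = (λ z≡1 → <-irrefl (sym (cong ⌊_/2⌋ z≡1)) 1≤i) , z≢M
      where
      z≢M : z ≢ M
      z≢M z≡M = <-irrefl (trans (cong ⌊_/2⌋ z≡M) (trans ⌊M/2⌋≡N N≡1+L)) (s≤s i≤L)

    label-mid : ∀ {x} → Odd x → Mid x → label ⌊ x /2⌋ ≡ om ⌊ x /2⌋
    label-mid {x} ox (x≢1 , x≢M) = label-om (λ i≡0 → <-irrefl (sym i≡0) (odd≢1⇒1≤⌊/2⌋ ox x≢1))
      (λ i≡N → x≢M (odd-injective ox M-odd (trans i≡N (sym ⌊M/2⌋≡N))))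

    label-M : label ⌊ M /2⌋ ≡ top
    label-M = trans (cong label ⌊M/2⌋≡N) label-N

    odd-arc : ∀ {x y} → x < suc M → y < suc M → Odd x → Odd y →
              label ⌊ x /2⌋ ▷ label ⌊ y /2⌋ → Arc x y
    odd-arc {x} {y} x< y< ox oy d =
      by-parity x y ox oy ((x< , y< , (λ { refl → ▷-asym _ _ d d }) , odd-comparable x< y< ox oy) , d)

    mid⇝mid : ∀ {x y} → x < suc M → y < suc M → Odd x → Odd y → Mid x → Mid y →
              ⌊ x /2⌋ ⇝ ⌊ y /2⌋ → Arc x y
    mid⇝mid x< y< ox oy mx my p =
      odd-arc x< y< ox oy (subst₂ _▷_ (sym (label-mid ox mx)) (sym (label-mid oy my)) p)

    even-arc : ∀ {x y} → x < suc M → y < suc M → Even x → Even y → ⌊ x /2⌋ ⇝ ⌊ y /2⌋ → Arc x y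
    even-arc {x} {y} x< y< ex ey p = by-parity x y ex ey
      (subst₂ (Adj M) (sym (even⇒double x ex)) (sym (even⇒double y ey))
        (Adj-double N (a< , b< , (λ a≡b → ⇝-irrefl (subst (_⇝ ⌊ y /2⌋) a≡b p)) , Q-complete a< b<)) , p)
      where
      a< : ⌊ x /2⌋ < Q
      a< = ⌊/2⌋<-cancel x<
      b< : ⌊ y /2⌋ < Q
      b< = ⌊/2⌋<-cancel y<

    mid→even : ∀ {x y} → x < suc M → y < suc M → Odd x → Even y → Mid x → ¬ q ∣ x → Arc x y
    mid→even {x} {y} x< y< ox ey mx q∤x = by-parity x y ox ey (generator-Adj x< y< ox q∤x (odd≢even ox ey) , mx)

    even→1 : ∀ {x} → x < suc M → Even x → Arc x 1
    even→1 {x} x< ex =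
      by-parity x 1 ex refl ((x< , 1< , odd≢even refl ex ∘ sym , inj₁ (PowerOf-1 x<)) , inj₁ refl)

    even→M : ∀ {x} → x < suc M → Even x → Arc x M
    even→M {x} x< ex =
      by-parity x M ex M-odd (Adj-sym (generator-Adj M< x< M-odd q∤M (odd≢even M-odd ex)) , inj₂ refl)

    index≤L : ∀ {z} → suc (suc z) ≤ M → ⌊ z /2⌋ ≤ L
    index≤L {z} le = ≤-pred (subst (suc ⌊ z /2⌋ ≤_) (trans ⌊M/2⌋≡N N≡1+L) (⌊n/2⌋-mono le))

    1→M : Arc 1 M
    1→M = odd-arc 1< M< refl M-odd (subst (one ▷_) (sym label-M) tt)

    1→mid : ∀ {y} → y < suc M → Odd y → Mid y → ⌊ y /2⌋ ≢ 1 → Arc 1 y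
    1→mid y< oy my i≢1 = odd-arc 1< y< refl oy (subst (one ▷_) (sym (label-mid oy my)) i≢1)

    M→mid : ∀ {y} → y < suc M → Odd y → Mid y → Arc M y
    M→mid y< oy my = odd-arc M< y< M-odd oy (subst₂ _▷_ (sym label-M) (sym (label-mid oy my)) tt)

    mid→1 : ∀ {x} → x < suc M → Odd x → Mid x → ⌊ x /2⌋ ≡ 1 → Arc x 1
    mid→1 x< ox mx i≡1 = odd-arc x< 1< ox refl (subst (_▷ one) (sym (label-mid ox mx)) i≡1)

    mid→0 : ∀ {x} → x < suc M → Odd x → Mid x → Arc x 0
    mid→0 {x} x< ox mx = by-parity x 0 ox refl ((x< , s≤s z≤n , odd≢even ox refl , inj₂ (PowerOf-0 M x)) , mx)

    classify : ∀ x → x ≡ 1 ⊎ x ≡ M ⊎ Mid x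
    classify x with x ≟ 1 | x ≟ M
    ... | yes x≡1 | _ = inj₁ x≡1
    ... | no _ | yes x≡M = inj₂ (inj₁ x≡M)
    ... | no x≢1 | no x≢M = inj₂ (inj₂ (x≢1 , x≢M))

    u : ℕ
    u = suc (suc q)

    u< : u < suc M
    u< = index≤L⇒< q-odd (index≤L q+4≤M)

    u-mid : Mid u
    u-mid = index⇒mid (s≤s z≤n) (index≤L q+4≤M)

    u-index≢1 : ⌊ u /2⌋ ≢ 1
    u-index≢1 e = <-irrefl (sym (suc-injective e)) (⌊n/2⌋-mono 2<q)

    q∤u : ¬ q ∣ u
    q∤u = ∣⇒∤small+ ∣-refl (s≤s z≤n) 2<q

    q∤4 : ¬ q ∣ 4
    q∤4 q∣4 with ∣p^β⇒≡p^j prime[2] 2 q∣4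
    ... | zero , q≡1 = <-irrefl (sym q≡1) (<-trans (s≤s (s≤s z≤n)) 2<q)
    ... | suc j , q≡2^j+1 = odd⇒2∤ q-odd (divides (2 ^ j) (trans q≡2^j+1 (*-comm 2 (2 ^ j))))

    reach-even-even : ∀ {x y} → x < suc M → y < suc M → Even x → Even y → Reach₂ Arc x y
    reach-even-even {x} {y} x< y< ex ey with x ≟ y
    ... | yes refl = stay
    ... | no x≢y with ⇝-reach₂ 0 K z≤n (≤-pred (⌊/2⌋<-cancel x<)) z≤n (≤-pred (⌊/2⌋<-cancel y<))
                            (x≢y ∘ even-injective ex ey)
    ...   | inj₁ p = arc (even-arc x< y< ex ey p)
    ...   | inj₂ (r , (_ , r≤N) , p₁ , p₂) =
            via (r + r) (even-arc x< z< ex (even-double r) (subst (_ ⇝_) (sym (⌊k+k/2⌋≡k r)) p₁))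
                        (even-arc z< y< (even-double r) ey (subst (_⇝ _) (sym (⌊k+k/2⌋≡k r)) p₂))
      where
      z< : r + r < suc M
      z< = +-mono-< (s≤s r≤N) (s≤s r≤N)

    reach-even-odd : ∀ {x y} → x < suc M → y < suc M → Even x → Odd y → Reach₂ Arc x y
    reach-even-odd {x} {y} x< y< ex oy with classify y
    ... | inj₁ refl = arc (even→1 x< ex)
    ... | inj₂ (inj₁ refl) = arc (even→M x< ex)
    ... | inj₂ (inj₂ my) = via M (even→M x< ex) (M→mid y< oy my)

    -- x + 2 is a generator beaten by x; at the top of the range use x − 4 instead, as q ∤ 4.
    reach-multiple-of-q : ∀ {x y} → x < suc M → y < suc M → Odd x → Even y → Mid x → q ∣ x →
                          Reach₂ Arc x y
    reach-multiple-of-q {x} {y} x< y< ox ey mx q∣x with mid-index ox x< mx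
    ... | 1≤i , i≤L with m≤n⇒m<n∨m≡n i≤L
    ...   | inj₁ i<L = via (suc (suc x)) (mid⇝mid x< z< ox ox mx mz (⇝-suc ⌊ x /2⌋))
                                         (mid→even z< y< ox ey mz (∣⇒∤small+ q∣x (s≤s z≤n) 2<q))
      where
      z< : suc (suc x) < suc M
      z< = index≤L⇒< ox i<L
      mz : Mid (suc (suc x))
      mz = index⇒mid (s≤s z≤n) i<L
    ...   | inj₂ i≡L = via z (mid⇝mid x< z< ox oz mx mz (subst (⌊ x /2⌋ ⇝_) (sym ⌊z/2⌋≡r) (inj₂ (0 , i≡r+2))))
                             (mid→even z< y< oz ey mz q∤z)
      where
      r z : ℕ
      r = suc (K₀ + K₀)
      z = suc (r + r)
      oz : Odd z
      oz = odd-suc-double r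
      ⌊z/2⌋≡r : ⌊ z /2⌋ ≡ r
      ⌊z/2⌋≡r = ⌊1+k+k/2⌋≡k r
      i≡r+2 : ⌊ x /2⌋ ≡ r + 2
      i≡r+2 = trans i≡L (top-mid K₀)
        where
        top-mid : ∀ k → suc (suc k + suc k) ≡ suc (k + k) + 2
        top-mid = solve-∀
      r≤L : ⌊ z /2⌋ ≤ L
      r≤L = subst (_≤ L) (sym ⌊z/2⌋≡r) (s≤s (+-mono-≤ (n≤1+n K₀) (n≤1+n K₀)))
      z< : z < suc M
      z< = index≤L⇒< oz r≤L
      mz : Mid z
      mz = index⇒mid (subst (1 ≤_) (sym ⌊z/2⌋≡r) (s≤s z≤n)) r≤L
      x≡z+4 : x ≡ z + 4
      x≡z+4 = trans (odd⇒suc-double x ox) (trans (cong (λ i → suc (i + i)) i≡r+2) (shift r))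
        where
        shift : ∀ r → suc (r + 2 + (r + 2)) ≡ suc (r + r) + 4
        shift = solve-∀
      q∤z : ¬ q ∣ z
      q∤z q∣z = q∤4 (∣m+n∣m⇒∣n (subst (q ∣_) x≡z+4 q∣x) q∣z)

    reach-odd-even : ∀ {x y} → x < suc M → y < suc M → Odd x → Even y → Reach₂ Arc x y
    reach-odd-even {x} {y} x< y< ox ey with classify x
    ... | inj₁ refl = via u (1→mid u< q-odd u-mid u-index≢1) (mid→even u< y< q-odd ey u-mid q∤u)
    ... | inj₂ (inj₁ refl) = via u (M→mid u< q-odd u-mid) (mid→even u< y< q-odd ey u-mid q∤u)
    ... | inj₂ (inj₂ mx) with q ∣? x
    ...   | no q∤x = arc (mid→even x< y< ox ey mx q∤x)
    ...   | yes q∣x = reach-multiple-of-q x< y< ox ey mx q∣x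

    reach-from-1 : ∀ {y} → y < suc M → Odd y → Reach₂ Arc 1 y
    reach-from-1 {y} y< oy with classify y
    ... | inj₁ refl = stay
    ... | inj₂ (inj₁ refl) = arc 1→M
    ... | inj₂ (inj₂ my) with ⌊ y /2⌋ ≟ 1
    ...   | no i≢1 = arc (1→mid y< oy my i≢1)
    ...   | yes _ = via M 1→M (M→mid y< oy my)

    reach-from-M : ∀ {y} → y < suc M → Odd y → Reach₂ Arc M y
    reach-from-M {y} y< oy with classify y
    ... | inj₁ refl = via 3 (M→mid 3< refl 3-mid) (mid→1 3< refl 3-mid refl)
      where
      3< : 3 < suc M
      3< = index≤L⇒< refl (s≤s z≤n)
      3-mid : Mid 3
      3-mid = index⇒mid (s≤s z≤n) (s≤s z≤n)
    ... | inj₂ (inj₁ refl) = stay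
    ... | inj₂ (inj₂ my) = arc (M→mid y< oy my)

    reach-from-mid : ∀ {x y} → x < suc M → y < suc M → Odd x → Odd y → Mid x → Reach₂ Arc x y
    reach-from-mid {x} {y} x< y< ox oy mx with classify y
    ... | inj₁ refl with ⌊ x /2⌋ ≟ 1
    ...   | yes i≡1 = arc (mid→1 x< ox mx i≡1)
    ...   | no _ = via 0 (mid→0 x< ox mx) (even→1 (s≤s z≤n) refl)
    reach-from-mid {x} {y} x< y< ox oy mx | inj₂ (inj₁ refl) =
      via 0 (mid→0 x< ox mx) (even→M (s≤s z≤n) refl)
    reach-from-mid {x} {y} x< y< ox oy mx | inj₂ (inj₂ my) with x ≟ y
    ... | yes refl = stay
    ... | no x≢y with mid-index ox x< mx | mid-index oy y< my
    ...   | 1≤i , i≤L | 1≤j , j≤L with ⇝-reach₂ 1 K′ 1≤i i≤L 1≤j j≤L (x≢y ∘ odd-injective ox oy)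
    ...     | inj₁ p = arc (mid⇝mid x< y< ox oy mx my p)
    ...     | inj₂ (r , (1≤r , r≤L) , p₁ , p₂) =
              via z (mid⇝mid x< z< ox oz mx mz (subst (⌊ x /2⌋ ⇝_) (sym ⌊z/2⌋≡r) p₁))
                    (mid⇝mid z< y< oz oy mz my (subst (_⇝ ⌊ y /2⌋) (sym ⌊z/2⌋≡r) p₂))
      where
      z : ℕ
      z = suc (r + r)
      oz : Odd z
      oz = odd-suc-double r
      ⌊z/2⌋≡r : ⌊ z /2⌋ ≡ r
      ⌊z/2⌋≡r = ⌊1+k+k/2⌋≡k r
      z< : z < suc M
      z< = index≤L⇒< oz (subst (_≤ L) (sym ⌊z/2⌋≡r) r≤L)
      mz : Mid z
      mz = index⇒mid (subst (1 ≤_) (sym ⌊z/2⌋≡r) 1≤r) (subst (_≤ L) (sym ⌊z/2⌋≡r) r≤L)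

    reachP : ∀ p p′ {x y} → parity x ≡ p → parity y ≡ p′ → x < suc M → y < suc M → Reach₂ Arc x y
    reachP 0ℙ 0ℙ ex ey x< y< = reach-even-even x< y< ex ey
    reachP 0ℙ 1ℙ ex oy x< y< = reach-even-odd x< y< ex oy
    reachP 1ℙ 0ℙ ox ey x< y< = reach-odd-even x< y< ox ey
    reachP 1ℙ 1ℙ {x} ox oy x< y< with classify x
    ... | inj₁ refl = reach-from-1 y< oy
    ... | inj₂ (inj₁ refl) = reach-from-M y< oy
    ... | inj₂ (inj₂ mx) = reach-from-mid x< y< ox oy mx

    orientation : Diam₂Orientation M
    orientation = record
      { Arc = Arc
      ; sound = λ {x} {y} → soundP (parity x) (parity y)
      ; total = λ {x} {y} → totalP (parity x) (parity y) refl refl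
      ; asym = λ {x} {y} → asymP (parity x) (parity y)
      ; reach = λ {x} {y} → reachP (parity x) (parity y) refl refl }

-- ℤ₁₂

module CheckedTable (M : ℕ) (outs : ℕ → List ℕ) where

  Arc : ℕ → ℕ → Set
  Arc x y = Adj M x y × y ∈ outs x

  Arc? : ∀ x y → Dec (Arc x y)
  Arc? x y = Adj? M x y ×-dec y ∈? outs x

  Checked : ℕ → ℕ → Set
  Checked x y = (Adj M x y → Arc x y ⊎ Arc y x) × ¬ (Arc x y × Arc y x) ×
                (x ≡ y ⊎ Arc x y ⊎ ∃ λ z → z < suc M × Arc x z × Arc z y)

  Checked? : ∀ x y → Dec (Checked x y)
  Checked? x y = (Adj? M x y →-dec (Arc? x y ⊎-dec Arc? y x)) ×-dec ¬? (Arc? x y ×-dec Arc? y x) ×-dec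
                 (x ≟ y ⊎-dec Arc? x y ⊎-dec anyUpTo? (λ z → Arc? x z ×-dec Arc? z y) (suc M))

  module _ (checked : ∀ {x} → x < suc M → ∀ {y} → y < suc M → Checked x y) where

    orientation : Diam₂Orientation M
    orientation = record
      { Arc = Arc
      ; sound = proj₁
      ; total = λ { adj@(x< , y< , _) → proj₁ (checked x< y<) adj }
      ; asym = λ { a@((x< , y< , _) , _) b → proj₁ (proj₂ (checked x< y<)) (a , b) }
      ; reach = λ x< y< → reach (proj₂ (proj₂ (checked x< y<))) }
      where
      reach : ∀ {x y} → x ≡ y ⊎ Arc x y ⊎ (∃ λ z → z < suc M × Arc x z × Arc z y) → Reach₂ Arc x y
      reach (inj₁ refl) = stay
      reach (inj₂ (inj₁ a)) = arc a
      reach (inj₂ (inj₂ (z , _ , a , b))) = via z a b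

outs₁₂ : ℕ → List ℕ
outs₁₂ 0 = 1 ∷ 2 ∷ 4 ∷ 5 ∷ 7 ∷ 9 ∷ 10 ∷ []
outs₁₂ 1 = 7 ∷ 10 ∷ 11 ∷ []
outs₁₂ 2 = 1 ∷ 4 ∷ 6 ∷ 7 ∷ 8 ∷ 11 ∷ []
outs₁₂ 3 = 0 ∷ 1 ∷ 6 ∷ 7 ∷ 9 ∷ []
outs₁₂ 4 = 1 ∷ 5 ∷ 7 ∷ 8 ∷ []
outs₁₂ 5 = 1 ∷ 2 ∷ 3 ∷ 6 ∷ 10 ∷ []
outs₁₂ 6 = 0 ∷ 1 ∷ 9 ∷ 11 ∷ []
outs₁₂ 7 = 5 ∷ 6 ∷ 8 ∷ 9 ∷ 11 ∷ []
outs₁₂ 8 = 0 ∷ 1 ∷ 5 ∷ []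
outs₁₂ 9 = 1 ∷ 5 ∷ 11 ∷ []
outs₁₂ 10 = 2 ∷ 4 ∷ 6 ∷ 7 ∷ 8 ∷ 11 ∷ []
outs₁₂ 11 = 0 ∷ 3 ∷ 4 ∷ 5 ∷ 8 ∷ []
outs₁₂ _ = []

orientation₁₂ : Diam₂Orientation 11
orientation₁₂ = orientation (from-yes (allUpTo? (λ x → allUpTo? (Checked? x) 12) 12))
  where open CheckedTable 11 outs₁₂

-- ℤ₆

pattern f0 = fzero
pattern f1 = fsuc f0
pattern f2 = fsuc f1
pattern f3 = fsuc f2
pattern f4 = fsuc f3
pattern f5 = fsuc f4

PowAdj-sym : ∀ {m} .{{_ : NonZero m}} {x y : Fin m} → PowAdj m x y → PowAdj m y x
PowAdj-sym (x≢y , p) = x≢y ∘ sym , swap p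

3≁2 : ¬ PowAdj 6 f3 f2
3≁2 = from-no (PowerOf? 5 3 2 ⊎-dec PowerOf? 5 2 3) ∘ proj₂

3≁4 : ¬ PowAdj 6 f3 f4
3≁4 = from-no (PowerOf? 5 3 4 ⊎-dec PowerOf? 5 4 3) ∘ proj₂

module _ {A : Fin 6 → Fin 6 → Set} (adj : ∀ {x y} → A x y → PowAdj 6 x y)
         (asym : ∀ {x y} → A x y → ¬ A y x) (reach : ∀ x y → Reach₂ A x y) where

  open SoleNeighbour _≟ᶠ_ asym reach

  private
    either : ∀ {w a} → A w f3 ⊎ w ≡ a → A f3 w → w ≡ a
    either (inj₁ w→3) 3→w = ⊥-elim (asym 3→w w→3)
    either (inj₂ w≡a) _ = w≡a

  out-of-3⊆ : ∀ {a} → (A f0 f3 ⊎ f0 ≡ a) → (A f1 f3 ⊎ f1 ≡ a) → (A f5 f3 ⊎ f5 ≡ a) →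
              ∀ w → A f3 w → w ≡ a
  out-of-3⊆ h₀ _ _ f0 = either h₀
  out-of-3⊆ _ h₁ _ f1 = either h₁
  out-of-3⊆ _ _ _ f2 = ⊥-elim ∘ 3≁2 ∘ adj
  out-of-3⊆ _ _ _ f3 = λ a → ⊥-elim (proj₁ (adj a) refl)
  out-of-3⊆ _ _ _ f4 = ⊥-elim ∘ 3≁4 ∘ adj
  out-of-3⊆ _ _ h₅ f5 = either h₅

  -- 3 would then be the sole in-neighbour of a, leaving 2 or 4 (not adjacent to 3) no way into a.
  ≤1-out-of-3⇒⊥ : ∀ {a} → (A f0 f3 ⊎ f0 ≡ a) → (A f1 f3 ⊎ f1 ≡ a) → (A f5 f3 ⊎ f5 ≡ a) → ⊥
  ≤1-out-of-3⇒⊥ {a} h₀ h₁ h₅ with f2 ≟ᶠ a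
  ... | no 2≢a = 3≁2 (PowAdj-sym (adj (sole-out-neighbour⇒arc-to (out-of-3⊆ h₀ h₁ h₅) (λ ()) 2≢a)))
  ... | yes refl = 3≁4 (PowAdj-sym (adj (sole-out-neighbour⇒arc-to (out-of-3⊆ h₀ h₁ h₅) (λ ()) (λ ()))))

ℤ₆-¬DiamLe2 : (A : Fin 6 → Fin 6 → Set) → IsOrientation (PowAdj 6) A → ¬ DiamLe A 2
ℤ₆-¬DiamLe2 A (sound , total , asym′) diam =
  by-directions (total f3 f0 ((λ ()) , inj₂ (0 , refl))) (total f3 f1 ((λ ()) , inj₁ (3 , refl)))
                (total f3 f5 ((λ ()) , inj₁ (3 , refl)))
  where
  adj : ∀ {x y} → A x y → PowAdj 6 x y
  adj = sound _ _
  asym : ∀ {x y} → A x y → ¬ A y x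
  asym = asym′ _ _
  reach : ∀ x y → Reach₂ A x y
  reach x y = DistLe⇒Reach₂ (diam x y)
  adjᵒ : ∀ {x y} → A y x → PowAdj 6 x y
  adjᵒ = PowAdj-sym ∘ adj
  asymᵒ : ∀ {x y} → A y x → ¬ A x y
  asymᵒ a b = asym b a
  reachᵒ : ∀ x y → Reach₂ (flip A) x y
  reachᵒ x y = Reach₂-flip (reach y x)
  ≤1-out : ∀ {a} → (A f0 f3 ⊎ f0 ≡ a) → (A f1 f3 ⊎ f1 ≡ a) → (A f5 f3 ⊎ f5 ≡ a) → ⊥
  ≤1-out = ≤1-out-of-3⇒⊥ adj asym reach
  ≤1-in : ∀ {a} → (A f3 f0 ⊎ f0 ≡ a) → (A f3 f1 ⊎ f1 ≡ a) → (A f3 f5 ⊎ f5 ≡ a) → ⊥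
  ≤1-in = ≤1-out-of-3⇒⊥ adjᵒ asymᵒ reachᵒ
  -- Two of the three edges at 3 point the same way.
  by-directions : A f3 f0 ⊎ A f0 f3 → A f3 f1 ⊎ A f1 f3 → A f3 f5 ⊎ A f5 f3 → ⊥
  by-directions (inj₂ 0→3) (inj₂ 1→3) _          = ≤1-out (inj₁ 0→3) (inj₁ 1→3) (inj₂ refl)
  by-directions (inj₂ 0→3) (inj₁ _)   (inj₂ 5→3) = ≤1-out (inj₁ 0→3) (inj₂ refl) (inj₁ 5→3)
  by-directions (inj₁ _)   (inj₂ 1→3) (inj₂ 5→3) = ≤1-out (inj₂ refl) (inj₁ 1→3) (inj₁ 5→3)
  by-directions (inj₁ 3→0) (inj₁ 3→1) _          = ≤1-in (inj₁ 3→0) (inj₁ 3→1) (inj₂ refl)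
  by-directions (inj₁ 3→0) (inj₂ _)   (inj₁ 3→5) = ≤1-in (inj₁ 3→0) (inj₂ refl) (inj₁ 3→5)
  by-directions (inj₂ _)   (inj₁ 3→1) (inj₁ 3→5) = ≤1-in (inj₂ refl) (inj₁ 3→1) (inj₁ 3→5)

-- The tower ℤ_{2^α Q}

odd-≢3⇒5≤ : ∀ {n} → Odd n → 3 ≤ n → n ≢ 3 → 5 ≤ n
odd-≢3⇒5≤ {1} _ (s≤s ()) _
odd-≢3⇒5≤ {3} _ _ n≢3 = ⊥-elim (n≢3 refl)
odd-≢3⇒5≤ {4} () _ _
odd-≢3⇒5≤ {suc (suc (suc (suc (suc n))))} _ _ _ = s≤s (s≤s (s≤s (s≤s (s≤s z≤n))))

q^β≡3⇒β≡1×q≡3 : ∀ {q} β → 3 ≤ q → 1 ≤ β → q ^ β ≡ 3 → β ≡ 1 × q ≡ 3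
q^β≡3⇒β≡1×q≡3 {q} (suc zero) _ _ e = refl , trans (sym (*-identityʳ q)) e
q^β≡3⇒β≡1×q≡3 {q} (suc (suc c)) 3≤q _ e =
  ⊥-elim (<-irrefl (sym e) (≤-trans 4≤9 (*-mono-≤ 3≤q (≤-trans 3≤q q≤q^c+1))))
  where
  instance _ = >-nonZero (≤-trans (s≤s z≤n) 3≤q)
  4≤9 : 4 ≤ 3 * 3
  4≤9 = s≤s (s≤s (s≤s (s≤s z≤n)))
  q≤q^c+1 : q ≤ q ^ suc c
  q≤q^c+1 = m≤m*n q (q ^ c) {{m^n≢0 q c}}

m∣m^n : ∀ m {n} → 1 ≤ n → m ∣ m ^ n
m∣m^n m {suc n} _ = m∣m*n (m ^ n)

module Tower {q β : ℕ} (pq : Prime q) (2<q : 2 < q) (1≤β : 1 ≤ β) where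

  Q : ℕ
  Q = q ^ β

  instance
    q≢0 : NonZero q
    q≢0 = prime⇒nonZero pq

  q-odd : Odd q
  q-odd = 2∤⇒odd λ 2∣q → 2≢q (prime⇒irreducible pq 2∣q)
    where
    2≢q : ¬ (2 ≡ 1 ⊎ 2 ≡ q)
    2≢q (inj₂ refl) = <-irrefl refl 2<q

  Q-odd : Odd Q
  Q-odd = odd-^ q-odd β

  q≤Q : q ≤ Q
  q≤Q = subst (_≤ Q) (*-identityʳ q) (^-monoʳ-≤ q 1≤β)

  q∣Q : q ∣ Q
  q∣Q = m∣m^n q 1≤β

  odd-residues : ∀ a M → suc M ≡ 2 ^ a * Q → OddResidues M
  odd-residues a M n≡ = record
    { q = q ; 2<q = 2<q ; q-odd = q-odd
    ; q∣n = subst (q ∣_) (sym n≡) (∣n⇒∣m*n (2 ^ a) q∣Q)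
    ; odd-comparable = λ {x} {y} x< y< ox oy →
        gcds∣p^β⇒comparable pq β M x< y< (gcd∣Q x ox) (gcd∣Q y oy)
    ; odd-generator = λ {u} u< y< ou q∤u → gcd∣p^β∧p∤⇒generator pq β M y< q∤u (gcd∣Q u ou) }
    where
    gcd∣Q : ∀ x → Odd x → gcd x (suc M) ∣ Q
    gcd∣Q x ox = subst (λ n → gcd x n ∣ Q) (sym n≡) (gcd[odd,2^a*m]∣m a Q {x} ox)

  Stage : ℕ → Set₁
  Stage a = Σ ℕ λ M → suc M ≡ 2 ^ a * Q × Diam₂Orientation M

  2^[1+a]*Q≡ : ∀ a → 2 ^ suc a * Q ≡ 2 ^ a * Q + 2 ^ a * Q
  2^[1+a]*Q≡ a = trans (*-assoc 2 (2 ^ a) Q) (cong (2 ^ a * Q +_) (+-identityʳ (2 ^ a * Q)))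

  2^[1+a]*Q-even : ∀ a → Even (2 ^ suc a * Q)
  2^[1+a]*Q-even a = subst Even (sym (*-assoc 2 (2 ^ a) Q)) (even-2* (2 ^ a * Q))

  double : ∀ a → Stage (suc a) → Stage (suc (suc a))
  double a (M′ , n≡ , G′)
    with ⌊ M′ /2⌋ | odd⇒suc-double M′ (suc-even⇒odd M′ (subst Even (sym n≡) (2^[1+a]*Q-even a)))
  ... | K | refl = _ , 2n≡ , Doubling.orientation K G′ (odd-residues (suc (suc a)) _ 2n≡)
    where
    2n≡ : suc (suc (K + K)) + suc (suc (K + K)) ≡ 2 ^ suc (suc a) * Q
    2n≡ = trans (cong₂ _+_ n≡ n≡) (sym (2^[1+a]*Q≡ (suc a)))

  raise : ∀ k {a} → Stage (suc a) → Stage (suc (k + a))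
  raise zero s = s
  raise (suc k) {a} s = double (k + a) (raise k s)

  stage₁ : 5 ≤ Q → Stage 1
  stage₁ 5≤Q with ⌊ Q /2⌋ | odd⇒suc-double Q Q-odd
  ... | suc (suc K₀) | Q≡ = _ , n≡ , Base.Construction.orientation K₀ (odd-residues 1 M n≡) Q-complete q+4≤M
    where
    open Base K₀ using (N; M)
    n≡ : suc M ≡ 2 ^ 1 * Q
    n≡ = trans (cong₂ _+_ (sym Q≡) (sym Q≡)) (cong (Q +_) (sym (+-identityʳ Q)))
    Q-complete : ∀ {a b} → a < suc N → b < suc N → PowerOf (suc N) a b ⊎ PowerOf (suc N) b a
    Q-complete {a} {b} a< b< = gcds∣p^β⇒comparable pq β N a< b< (gcd∣Q a) (gcd∣Q b)
      where
      gcd∣Q : ∀ x → gcd x (suc N) ∣ Q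
      gcd∣Q x = subst (gcd x (suc N) ∣_) (sym Q≡) (gcd[m,n]∣n x (suc N))
    q+4≤M : 4 + q ≤ M
    q+4≤M = +-mono-≤ (+-mono-≤ 2≤K 2≤K) (subst (q ≤_) Q≡ q≤Q)
      where
      2≤K : 2 ≤ suc (suc K₀)
      2≤K = s≤s (s≤s z≤n)
  ... | 0 | Q≡ with s≤s () ← subst (5 ≤_) Q≡ 5≤Q
  ... | 1 | Q≡ with s≤s (s≤s (s≤s ())) ← subst (5 ≤_) Q≡ 5≤Q

  stage₂ : Q ≡ 3 → Stage 2
  stage₂ Q≡3 = 11 , cong (2 ^ 2 *_) (sym Q≡3) , orientation₁₂

  stage : ∀ a → ¬ (suc a ≡ 1 × β ≡ 1 × q ≡ 3) → Stage (suc a)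
  stage a ¬exception with Q ≟ 3
  ... | no Q≢3 =
        subst Stage (cong suc (+-identityʳ a)) (raise a (stage₁ (odd-≢3⇒5≤ Q-odd (≤-trans 2<q q≤Q) Q≢3)))
  ... | yes Q≡3 with a
  ...   | zero = ⊥-elim (¬exception (refl , q^β≡3⇒β≡1×q≡3 β 2<q 1≤β Q≡3))
  ...   | suc a′ = subst Stage (cong suc (+-comm a′ 1)) (raise a′ (stage₂ Q≡3))

  stage⇒ODIs : ∀ a .{{_ : NonZero (2 ^ suc a * Q)}} → Stage (suc a) → ODIs (PowAdj (2 ^ suc a * Q)) 2
  stage⇒ODIs a (zero , n≡ , _) = ⊥-elim (even⇒¬odd 1 (subst Even (sym n≡) (2^[1+a]*Q-even a)) refl)
  stage⇒ODIs a (suc M , n≡ , D) = Diam₂Orientation⇒ODIs D _ (sym n≡)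

ℤ₆-exception : ∀ {q α β} .{{_ : NonZero (2 ^ α * q ^ β)}} →
  ODIs (PowAdj (2 ^ α * q ^ β)) 2 → ¬ (α ≡ 1 × β ≡ 1 × q ≡ 3)
ℤ₆-exception ((A , orientation , diam) , _) (refl , refl , refl) = ℤ₆-¬DiamLe2 A orientation diam

mainTheorem10 : (q α β : ℕ) → Prime q → q ≥ 3 → α ≥ 1 → β ≥ 1 →
    .{{_ : NonZero (2 ^ α * q ^ β)}} →
    ODIs (PowAdj (2 ^ α * q ^ β)) 2 ⇔ (¬ (α ≡ 1 × β ≡ 1 × q ≡ 3))
mainTheorem10 q (suc a) β pq q≥3 _ β≥1 =
  mk⇔ ℤ₆-exception (stage⇒ODIs a ∘ stage a)
  where open Tower pq q≥3 β≥1
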